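{- Let $k\ge 3$ and let $n$ be sufficiently large. Define $f(n,k)=\frac{n}{k}$ if $n$ is even and $f(n,k)=\frac{n-1}{2k}$ if $n$ is odd. If $n$ is even, then $f(n,k)\cdot\mathsf{m}(k-1)\le N(BM,k,n)\le N(GM,k,n)$. If $n$ is odd, then $f(n,k)\cdot\mathsf{m}(k-1)\le N(GM,k,n)$ and $f(n,k)\cdot\mathsf{m}(k-2)\le N(BM,k,n)$.
   Context: Majority problem: we are given $n$ balls indexed by $[n]=\{1,\dots,n\}$, each colored by one of two colors by an unknown coloring. A ball $i$ is a majority ball if more than $n/2$ balls (counting $i$) have the same color as $i$. The goal is to either identify a majority ball or correctly conclude that there is none. A query is a $k$-element subset $Q\subseteq[n]$. In the non-adaptive version, a family of queries is fixed in advance; it is successful if for every coloring the answers determine a correct output (a ball that is a majority ball for every coloring consistent with the answers, or the conclusion that no majority ball exists for every coloring consistent with the answers). In the General Model (GM), the answer to a query $Q$ is YES if $Q$ contains two balls of different colors and NO otherwise. In Borzyszkowski's Model (BM), the answer is YES together with a pointed-out pair of balls in $Q$ of different colors if such a pair exists, and NO if all balls of $Q$ have the same color. $N(GM,k,n)$ and $N(BM,k,n)$ denote the minimum number of queries in a successful non-adaptive query family in the respective model. A hypergraph has Property B if its vertices can be two-colored so that no edge is monochromatic. For $k\ge 1$, $\mathsf{m}(k)$ denotes the minimum number of edges of a $k$-uniform hypergraph (on any number of vertices) that does not have Property B. -}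

module Defs where

open import Data.Nat using (ℕ; _≤_; _<_; _*_)
open import Data.Bool using (Bool; true; false; not; _xor_)
open import Data.Fin using (Fin)
open import Data.Fin.Subset using (Subset; _∈_; ∣_∣)
open import Data.Vec using (tabulate)
open import Data.Maybe using (Maybe; just; nothing)
open import Data.Product using (Σ; _×_; _,_; ∃)
open import Data.Sum using (_⊎_)
open import Relation.Nullary using (¬_)
open import Relation.Binary.PropositionalEquality using (_≡_)

Coloring : ℕ → Set
Coloring n = Fin n → Bool

sameColor : ∀ {n} → Coloring n → Fin n → Subset n
sameColor c i = tabulate (λ j → not (c j xor c i))

Majority : ∀ {n} → Coloring n → Fin n → Set
Majority {n} c i = n < 2 * ∣ sameColor c i ∣

Mono : ∀ {n} → Coloring n → Subset n → Set
Mono c S = ∀ i j → i ∈ S → j ∈ S → c i ≡ c j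

HasDiffPair : ∀ {n} → Coloring n → Subset n → Set
HasDiffPair c S = Σ _ λ i → Σ _ λ j → i ∈ S × j ∈ S × ¬ (c i ≡ c j)

-- General Model: answer true = YES, false = NO.
GMValid : ∀ {n} → Coloring n → Subset n → Bool → Set
GMValid c Q true  = HasDiffPair c Q
GMValid c Q false = Mono c Q

-- Borzyszkowski's Model: answer  just (i , j) = YES with pointed pair (i , j),
-- nothing = NO. The pair is chosen by the adversary (any valid pair).
BMValid : ∀ {n} → Coloring n → Subset n → Maybe (Fin n × Fin n) → Set
BMValid c Q nothing        = Mono c Q
BMValid c Q (just (i , j)) = i ∈ Q × j ∈ Q × ¬ (c i ≡ c j)

KUniform : ∀ {n q} → ℕ → (Fin q → Subset n) → Set
KUniform k Q = ∀ t → ∣ Q t ∣ ≡ k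

-- Non-adaptive success of a query family Q for a model with answer type A
-- and validity relation V: for every coloring c and every valid answer
-- sequence r for c, the answers determine a correct output, i.e. either some
-- ball is a majority ball in every coloring consistent with r, or no coloring
-- consistent with r has a majority ball.
Successful : ∀ {n q} {A : Set} → (Coloring n → Subset n → A → Set) →
             (Fin q → Subset n) → Set
Successful {n} {q} {A} V Q =
  (c : Coloring n) (r : Fin q → A) → (∀ t → V c (Q t) (r t)) →
  (Σ (Fin n) λ i → (c' : Coloring n) → (∀ t → V c' (Q t) (r t)) → Majority c' i)
  ⊎ ((c' : Coloring n) → (∀ t → V c' (Q t) (r t)) → (i : Fin n) → ¬ Majority c' i)

-- "a ≤ d · N(V,k,n)": every successful family of k-element queries has
-- q queries with a ≤ d * q.
LowerBound : {A : Set} → (n : ℕ) → (Coloring n → Subset n → A → Set) →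
             ℕ → ℕ → ℕ → Set
LowerBound n V k a d =
  (q : ℕ) (Q : Fin q → Subset n) → KUniform k Q → Successful V Q → a ≤ d * q

-- N(BM,k,n) ≤ N(GM,k,n): every successful GM family can be matched by a
-- successful BM family with no more queries.
BMleGM : ℕ → ℕ → Set
BMleGM n k =
  (q : ℕ) (Q : Fin q → Subset n) → KUniform k Q → Successful GMValid Q →
  Σ ℕ λ q' → Σ (Fin q' → Subset n) λ Q' →
    KUniform k Q' × Successful BMValid Q' × q' ≤ q

PropertyB : ∀ {v e} → (Fin e → Subset v) → Set
PropertyB {v} E = Σ (Coloring v) λ col → ∀ t → ¬ Mono col (E t)

IsMinNonB : ℕ → ℕ → Set
IsMinNonB k m =
  (Σ ℕ λ v → Σ (Fin m → Subset v) λ E → KUniform k E × ¬ PropertyB E)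
  × ((v e : ℕ) (E : Fin e → Subset v) → KUniform k E → ¬ PropertyB E → m ≤ e)

-- Counting incidences, the degrees of the balls add up to k times the number of queries.  For n = 2h
-- every ball x has degree at least m(k − 1), and for n = 2h + 1 any two balls i ≠ j have degrees summing
-- to at least m(k − 1) in GM and m(k − 2) in BM.  Otherwise the link of x (resp. of i and j), made of
-- k − 1 (resp. k − 2) further balls from every query through them, has fewer than m edges and hence a
-- proper 2-coloring.  For large n it extends to a coloring c that is a tie with x true (n even) or has
-- h + 1 true balls including i (n odd), and answers for c can be chosen that stay valid when x, i or j
-- is recolored.  One of the resulting colorings has a majority ball, yet each ball fails to be a
-- majority ball in one of them, so no output of the family is correct.
module Submission where

open import Defs
open import Data.Nat using (ℕ; _≤_; _*_; _∸_; _%_)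
open import Data.Product using (Σ; _×_)
open import Relation.Binary.PropositionalEquality using (_≡_)

open import Data.Bool using (Bool; true; false; not; _xor_; if_then_else_)
import Data.Bool.Properties as B
open import Data.Fin as F using (Fin; zero; suc)
import Data.Fin.Properties as FP
open import Data.Fin.Subset
open import Data.Fin.Subset.Properties
open import Data.List using (List; length)
import Data.List as List
open import Data.List.Membership.Propositional using () renaming (_∈_ to _∈ₗ_)
open import Data.List.Membership.Propositional.Properties using (∈-lookup; ∈-map⁺; ∈-++⁺ˡ; ∈-++⁺ʳ)
open import Data.List.Properties using (length-++)
open import Data.List.Relation.Unary.All as All using (All)
import Data.List.Relation.Unary.All.Properties as All
open import Data.List.Relation.Unary.Any as Any using (index)
open import Data.List.Relation.Unary.Any.Properties using (lookup-index)
open import Data.Maybe using (Maybe; just; nothing; is-just)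
open import Data.Nat using (zero; suc; _+_; _⊓_; _<_; _/_; z≤n; s≤s)
open import Data.Nat.DivMod using (m≡m%n+[m/n]*n)
open import Data.Nat.Properties
open import Algebra.Properties.CommutativeMonoid.Sum +-0-commutativeMonoid using (sum-cong-≗; ∑-comm; sum-syntax)
open import Data.Product using (_,_; proj₁; proj₂)
open import Data.Sum as Sum using (_⊎_; inj₁; inj₂; [_,_]′)
open import Data.Vec using (_∷_; []; here; there; tabulate; lookup)
import Data.Vec.Functional as VF
open import Data.Vec.Properties using (lookup∘tabulate; lookup⇒[]=; []=⇒lookup)
open import Function using (_∘_)
open import Relation.Binary.PropositionalEquality
  using (refl; sym; trans; cong; cong₂; subst; subst₂; _≢_; module ≡-Reasoning)
open import Relation.Nullary using (¬_; Dec; yes; no; does; contradiction; _×-dec_; ¬?)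
open import Relation.Nullary.Decidable using (decidable-stable; dec-true)

private
  variable
    n q : ℕ

∣p∪q∣≤∣p∣+∣q∣ : (p q : Subset n) → ∣ p ∪ q ∣ ≤ ∣ p ∣ + ∣ q ∣
∣p∪q∣≤∣p∣+∣q∣ []          []          = z≤n
∣p∪q∣≤∣p∣+∣q∣ (true ∷ p)  (true ∷ q)  = s≤s (≤-trans (∣p∪q∣≤∣p∣+∣q∣ p q) (+-monoʳ-≤ ∣ p ∣ (n≤1+n _)))
∣p∪q∣≤∣p∣+∣q∣ (true ∷ p)  (false ∷ q) = s≤s (∣p∪q∣≤∣p∣+∣q∣ p q)
∣p∪q∣≤∣p∣+∣q∣ (false ∷ p) (true ∷ q)  = ≤-trans (s≤s (∣p∪q∣≤∣p∣+∣q∣ p q)) (≤-reflexive (sym (+-suc ∣ p ∣ ∣ q ∣)))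
∣p∪q∣≤∣p∣+∣q∣ (false ∷ p) (false ∷ q) = ∣p∪q∣≤∣p∣+∣q∣ p q

∣⋃∣≤ : ∀ {s} (L : List (Subset n)) → All (λ e → ∣ e ∣ ≤ s) L → ∣ ⋃ L ∣ ≤ length L * s
∣⋃∣≤ {n} List.[]      All.[]           = ≤-reflexive (∣⊥∣≡0 n)
∣⋃∣≤     (e List.∷ L) (e≤ All.∷ L≤) = ≤-trans (∣p∪q∣≤∣p∣+∣q∣ e (⋃ L)) (+-mono-≤ e≤ (∣⋃∣≤ L L≤))

⊆⋃ : ∀ {e : Subset n} {L} → e ∈ₗ L → e ⊆ ⋃ L
⊆⋃ {L = e List.∷ L} (Any.here refl) = p⊆p∪q (⋃ L)
⊆⋃ {L = e List.∷ L} (Any.there e∈)  = q⊆p∪q e (⋃ L) ∘ ⊆⋃ e∈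

⋃⊆ : ∀ {p : Subset n} {L} → All (_⊆ p) L → ⋃ L ⊆ p
⋃⊆ All.[]                    x∈⊥ = contradiction x∈⊥ ∉⊥
⋃⊆ {L = e List.∷ L} (e⊆ All.∷ L⊆) x∈ = [ e⊆ , ⋃⊆ L⊆ ]′ (x∈p∪q⁻ e (⋃ L) x∈)

x∈p─q⇒x∉q : ∀ (p q : Subset n) {x} → x ∈ p ─ q → x ∉ q
x∈p─q⇒x∉q (_ ∷ p) (true  ∷ q) (there x∈) (there x∈q) = x∈p─q⇒x∉q p q x∈ x∈q
x∈p─q⇒x∉q (_ ∷ p) (false ∷ q) (there x∈) (there x∈q) = x∈p─q⇒x∉q p q x∈ x∈q

∣p∣≤∣p─q∣+∣q∣ : (p q : Subset n) → ∣ p ∣ ≤ ∣ p ─ q ∣ + ∣ q ∣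
∣p∣≤∣p─q∣+∣q∣ p q = ≤-trans (p⊆q⇒∣p∣≤∣q∣ p⊆p─q∪q) (∣p∪q∣≤∣p∣+∣q∣ (p ─ q) q)
  where
  p⊆p─q∪q : p ⊆ (p ─ q) ∪ q
  p⊆p─q∪q {x} x∈p with x ∈? q
  ... | yes x∈q = x∈p∪q⁺ (inj₂ x∈q)
  ... | no  x∉q = x∈p∪q⁺ (inj₁ (x∈p∧x∉q⇒x∈p─q x∈p x∉q))

p-x⊆p─r : ∀ {p r : Subset n} x → (∀ {y} → y ∈ r → y ≢ x → y ∉ p) → p - x ⊆ p ─ r
p-x⊆p─r {p = p} x only-x {y} y∈ =
  x∈p∧x∉q⇒x∈p─q y∈p λ y∈r → only-x y∈r (x∉⁅y⁆⇒x≢y (x∈p─q⇒x∉q p ⁅ x ⁆ y∈)) y∈p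
  where
  y∈p : y ∈ p
  y∈p = p─q⊆p p ⁅ x ⁆ y∈

∣p∣≡1+∣q∣ : ∀ {p q : Subset n} {x} → x ∈ p → x ∉ q → q ⊆ p → p ⊆ q ∪ ⁅ x ⁆ → ∣ p ∣ ≡ suc ∣ q ∣
∣p∣≡1+∣q∣ {p = p} {q} {x} x∈p x∉q q⊆p p⊆q∪x = ≤-antisym
  (begin
    ∣ p ∣             ≤⟨ p⊆q⇒∣p∣≤∣q∣ p⊆q∪x ⟩
    ∣ q ∪ ⁅ x ⁆ ∣     ≤⟨ ∣p∪q∣≤∣p∣+∣q∣ q ⁅ x ⁆ ⟩
    ∣ q ∣ + ∣ ⁅ x ⁆ ∣ ≡⟨ cong (∣ q ∣ +_) (∣⁅x⁆∣≡1 x) ⟩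
    ∣ q ∣ + 1         ≡⟨ +-comm ∣ q ∣ 1 ⟩
    suc ∣ q ∣         ∎)
  (p⊂q⇒∣p∣<∣q∣ (q⊆p , x , x∈p , x∉q))
  where open ≤-Reasoning

∈⁅i⁆∪⁅j⁆ : ∀ {i j y : Fin n} → y ∈ ⁅ i ⁆ ∪ ⁅ j ⁆ → y ≡ i ⊎ y ≡ j
∈⁅i⁆∪⁅j⁆ {i = i} {j} y∈ = Sum.map (x∈⁅y⁆⇒x≡y i) (x∈⁅y⁆⇒x≡y j) (x∈p∪q⁻ ⁅ i ⁆ ⁅ j ⁆ y∈)

∣⁅i⁆∪⁅j⁆∣≤2 : ∀ (i j : Fin n) → ∣ ⁅ i ⁆ ∪ ⁅ j ⁆ ∣ ≤ 2
∣⁅i⁆∪⁅j⁆∣≤2 i j = ≤-trans (∣p∪q∣≤∣p∣+∣q∣ ⁅ i ⁆ ⁅ j ⁆) (≤-reflexive (cong₂ _+_ (∣⁅x⁆∣≡1 i) (∣⁅x⁆∣≡1 j)))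

firsts : ℕ → Subset n → Subset n
firsts zero    p           = ⊥
firsts (suc s) []          = []
firsts (suc s) (true ∷ p)  = true ∷ firsts s p
firsts (suc s) (false ∷ p) = false ∷ firsts (suc s) p

firsts-⊆ : ∀ s (p : Subset n) → firsts s p ⊆ p
firsts-⊆ zero    p           x∈⊥        = contradiction x∈⊥ ∉⊥
firsts-⊆ (suc s) (true ∷ p)  here       = here
firsts-⊆ (suc s) (true ∷ p)  (there x∈) = there (firsts-⊆ s p x∈)
firsts-⊆ (suc s) (false ∷ p) (there x∈) = there (firsts-⊆ (suc s) p x∈)

∣firsts∣ : ∀ s (p : Subset n) → ∣ firsts s p ∣ ≡ s ⊓ ∣ p ∣
∣firsts∣ {n} zero    p           = ∣⊥∣≡0 n
∣firsts∣     (suc s) []          = refl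
∣firsts∣     (suc s) (true ∷ p)  = cong suc (∣firsts∣ s p)
∣firsts∣     (suc s) (false ∷ p) = ∣firsts∣ (suc s) p

select : ∀ {A : Set} → Subset q → (Fin q → A) → List A
select []          f = List.[]
select (true ∷ M)  f = f zero List.∷ select M (f ∘ suc)
select (false ∷ M) f = select M (f ∘ suc)

length-select : ∀ {A : Set} (M : Subset q) (f : Fin q → A) → length (select M f) ≡ ∣ M ∣
length-select []          f = refl
length-select (true ∷ M)  f = cong suc (length-select M (f ∘ suc))
length-select (false ∷ M) f = length-select M (f ∘ suc)

∈-select : ∀ {A : Set} {M : Subset q} (f : Fin q → A) {t} → t ∈ M → f t ∈ₗ select M f
∈-select {M = true ∷ M}  f here       = Any.here refl
∈-select {M = true ∷ M}  f (there t∈) = Any.there (∈-select (f ∘ suc) t∈)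
∈-select {M = false ∷ M} f (there t∈) = ∈-select (f ∘ suc) t∈

select-All : ∀ {A : Set} {P : A → Set} (M : Subset q) {f : Fin q → A} → (∀ t → P (f t)) → All P (select M f)
select-All []          Pf = All.[]
select-All (true ∷ M)  Pf = Pf zero All.∷ select-All M (Pf ∘ suc)
select-All (false ∷ M) Pf = select-All M (Pf ∘ suc)

indicator : Bool → ℕ
indicator true  = 1
indicator false = 0

∣p∣≡∑ : (p : Subset n) → ∣ p ∣ ≡ ∑[ x < n ] indicator (lookup p x)
∣p∣≡∑ []          = refl
∣p∣≡∑ (true ∷ p)  = cong suc (∣p∣≡∑ p)
∣p∣≡∑ (false ∷ p) = ∣p∣≡∑ p

∑-const : ∀ q k → ∑[ t < q ] k ≡ q * k
∑-const zero    k = refl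
∑-const (suc q) k = cong (k +_) (∑-const q k)

∑-lower : ∀ {m} (f : Fin n → ℕ) → (∀ x → m ≤ f x) → n * m ≤ ∑[ x < n ] f x
∑-lower {zero}  f m≤f = z≤n
∑-lower {suc n} f m≤f = +-mono-≤ (m≤f zero) (∑-lower (f ∘ suc) (m≤f ∘ suc))

∑-pairs : ∀ {m} h (f : Fin n → ℕ) → 2 * h ≤ n → (∀ i j → i ≢ j → m ≤ f i + f j) → h * m ≤ ∑[ x < n ] f x
∑-pairs         zero    f _       _     = z≤n
∑-pairs {n} {m} (suc h) f 2h+2≤n pairs = step f (subst (_≤ n) (*-suc 2 h) 2h+2≤n) pairs
  where
  step : ∀ {n} (f : Fin n → ℕ) → suc (suc (2 * h)) ≤ n → (∀ i j → i ≢ j → m ≤ f i + f j) →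
    suc h * m ≤ ∑[ x < n ] f x
  step {suc (suc n)} f (s≤s (s≤s 2h≤n)) pairs = begin
    m + h * m                                          ≤⟨ +-mono-≤ (pairs zero (suc zero) λ ())
                                                            (∑-pairs h (λ x → f (suc (suc x))) 2h≤n λ i j i≢j →
                                                              pairs (suc (suc i)) (suc (suc j))
                                                                (i≢j ∘ FP.suc-injective ∘ FP.suc-injective)) ⟩
    f zero + f (suc zero) + ∑[ x < n ] f (suc (suc x)) ≡⟨ +-assoc (f zero) (f (suc zero)) _ ⟩
    ∑[ x < suc (suc n) ] f x                           ∎
    where open ≤-Reasoning

-- Color classes

-- sameColor c i is colorClass c (c i) by definition
colorClass : Coloring n → Bool → Subset n
colorClass c b = tabulate (λ j → not (c j xor b))

xnor-refl : ∀ a → not (a xor a) ≡ true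
xnor-refl true  = refl
xnor-refl false = refl

xnor⇒≡ : ∀ a b → not (a xor b) ≡ true → a ≡ b
xnor⇒≡ true  true  _ = refl
xnor⇒≡ false false _ = refl

xnor-injective : ∀ {a a′} b → not (a xor b) ≡ not (a′ xor b) → a ≡ a′
xnor-injective {true}  {true}  _     _  = refl
xnor-injective {false} {false} _     _  = refl
xnor-injective {true}  {false} true  ()
xnor-injective {true}  {false} false ()
xnor-injective {false} {true}  true  ()
xnor-injective {false} {true}  false ()

∈-colorClass⁺ : ∀ (c : Coloring n) {x b} → c x ≡ b → x ∈ colorClass c b
∈-colorClass⁺ c {x} refl = lookup⇒[]= x _ (trans (lookup∘tabulate _ x) (xnor-refl (c x)))

∈-colorClass⁻ : ∀ (c : Coloring n) {x b} → x ∈ colorClass c b → c x ≡ b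
∈-colorClass⁻ c {x} {b} x∈ = xnor⇒≡ (c x) b (trans (sym (lookup∘tabulate _ x)) ([]=⇒lookup x∈))

∣colorClass∣-complement : (c : Coloring n) (b : Bool) → ∣ colorClass c b ∣ + ∣ colorClass c (not b) ∣ ≡ n
∣colorClass∣-complement {zero}  c b = refl
∣colorClass∣-complement {suc n} c b =
  trans (split (c zero) b (colorClass (c ∘ suc) b) (colorClass (c ∘ suc) (not b)))
        (cong suc (∣colorClass∣-complement (c ∘ suc) b))
  where
  split : ∀ a b (p r : Subset n) → ∣ not (a xor b) ∷ p ∣ + ∣ not (a xor not b) ∷ r ∣ ≡ suc (∣ p ∣ + ∣ r ∣)
  split true  true  p r = refl
  split true  false p r = +-suc ∣ p ∣ ∣ r ∣
  split false true  p r = +-suc ∣ p ∣ ∣ r ∣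
  split false false p r = refl

∣colorClass∣-false : ∀ (c : Coloring n) {a b} → n ≡ a + b → ∣ colorClass c true ∣ ≡ a → ∣ colorClass c false ∣ ≡ b
∣colorClass∣-false c {a} {b} n≡a+b count =
  +-cancelˡ-≡ a _ b (trans (cong (_+ ∣ colorClass c false ∣) (sym count))
                           (trans (∣colorClass∣-complement c true) n≡a+b))

AgreeOff : Subset n → Coloring n → Coloring n → Set
AgreeOff R c c′ = ∀ {x} → x ∉ R → c′ x ≡ c x

AgreeOff-⊆ : ∀ {R R′ : Subset n} {c c′} → R ⊆ R′ → AgreeOff R c c′ → AgreeOff R′ c c′
AgreeOff-⊆ R⊆R′ agree y∉R′ = agree (y∉R′ ∘ R⊆R′)

∣colorClass∣-update : ∀ {c c′ : Coloring n} {x b} → AgreeOff ⁅ x ⁆ c c′ →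
  c x ≡ b → c′ x ≢ b → ∣ colorClass c b ∣ ≡ suc ∣ colorClass c′ b ∣
∣colorClass∣-update {c = c} {c′} {x} {b} agree cx≡b c′x≢b =
  ∣p∣≡1+∣q∣ (∈-colorClass⁺ c cx≡b) (c′x≢b ∘ ∈-colorClass⁻ c′) shrinks grows
  where
  shrinks : colorClass c′ b ⊆ colorClass c b
  shrinks {y} y∈ = ∈-colorClass⁺ c (trans (sym (agree (x≢y⇒x∉⁅y⁆ y≢x))) (∈-colorClass⁻ c′ y∈))
    where
    y≢x : y ≢ x
    y≢x refl = c′x≢b (∈-colorClass⁻ c′ y∈)
  grows : colorClass c b ⊆ colorClass c′ b ∪ ⁅ x ⁆
  grows {y} y∈ with y F.≟ x
  ... | yes refl = x∈p∪q⁺ (inj₂ (x∈⁅x⁆ x))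
  ... | no  y≢x  = x∈p∪q⁺ (inj₁ (∈-colorClass⁺ c′ (trans (agree (x≢y⇒x∉⁅y⁆ y≢x)) (∈-colorClass⁻ c y∈))))

paint : Subset n → Bool → Coloring n → Coloring n
paint R b c y = if does (y ∈? R) then b else c y

paint-∈ : ∀ {R : Subset n} {y} b c → y ∈ R → paint R b c y ≡ b
paint-∈ {R = R} {y} b c y∈R with y ∈? R
... | yes _   = refl
... | no  y∉R = contradiction y∈R y∉R

paint-∉ : ∀ {R : Subset n} b c → AgreeOff R c (paint R b c)
paint-∉ {R = R} b c {y} y∉R with y ∈? R
... | yes y∈R = contradiction y∈R y∉R
... | no  _   = refl

∣∷∣-cong : ∀ b {p r : Subset n} {d} → ∣ p ∣ ≡ ∣ r ∣ + d → ∣ b ∷ p ∣ ≡ ∣ b ∷ r ∣ + d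
∣∷∣-cong true  e = cong suc e
∣∷∣-cong false e = e

extend : (F : Subset n) (col : Coloring n) (d : ℕ) → d ≤ ∣ ∁ F ∣ →
  Σ (Coloring n) λ c → (∀ {x} → x ∈ F → c x ≡ col x) ×
                       ∣ colorClass c true ∣ ≡ ∣ F ∩ colorClass col true ∣ + d
extend []          col zero    _         = (λ ()) , (λ ()) , refl
extend (true ∷ F)  col d       d≤        with extend F (col ∘ suc) d d≤
... | c , agree , count =
  col zero VF.∷ c , agree′ ,
  ∣∷∣-cong (not (col zero xor true)) {colorClass c true} {F ∩ colorClass (col ∘ suc) true} count
  where
  agree′ : ∀ {x} → x ∈ true ∷ F → (col zero VF.∷ c) x ≡ col x
  agree′ here        = refl
  agree′ (there x∈F) = agree x∈F
extend (false ∷ F) col zero    _         with extend F (col ∘ suc) zero z≤n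
... | c , agree , count = false VF.∷ c , agree′ , count
  where
  agree′ : ∀ {x} → x ∈ false ∷ F → (false VF.∷ c) x ≡ col x
  agree′ (there x∈F) = agree x∈F
extend (false ∷ F) col (suc d) (s≤s d≤) with extend F (col ∘ suc) d d≤
... | c , agree , count = true VF.∷ c , agree′ , trans (cong suc count) (sym (+-suc _ d))
  where
  agree′ : ∀ {x} → x ∈ false ∷ F → (true VF.∷ c) x ≡ col x
  agree′ (there x∈F) = agree x∈F

balanced : (F : Subset n) (col : Coloring n) {a b : ℕ} → n ≡ a + b → ∣ F ∣ ≤ a → ∣ F ∣ ≤ b →
  Σ (Coloring n) λ c → (∀ {x} → x ∈ F → c x ≡ col x) × ∣ colorClass c true ∣ ≡ a
balanced F col {a} n≡a+b F≤a F≤b with extend F col (a ∸ ∣ F ∩ colorClass col true ∣) fits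
  where
  fits : a ∸ ∣ F ∩ colorClass col true ∣ ≤ ∣ ∁ F ∣
  fits = ≤-trans (m∸n≤m a ∣ F ∩ colorClass col true ∣)
                 (≤-trans (m+n≤o⇒m≤o∸n a (≤-trans (+-monoʳ-≤ a F≤b) (≤-reflexive (sym n≡a+b))))
                          (≤-reflexive (sym (∣∁p∣≡n∸∣p∣ F))))
... | c , agree , count = c , agree , trans count (m+[n∸m]≡n (≤-trans (∣p∩q∣≤∣p∣ F (colorClass col true)) F≤a))

Majority-intro : ∀ (c : Coloring n) {i b} → c i ≡ b → n < 2 * ∣ colorClass c b ∣ → Majority c i
Majority-intro c refl more = more

¬Majority-intro : ∀ (c : Coloring n) {i b} → c i ≡ b → 2 * ∣ colorClass c b ∣ ≤ n → ¬ Majority c i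
¬Majority-intro c refl fewer = ≤⇒≯ fewer

2*-as-+ : ∀ h → 2 * h ≡ h + h
2*-as-+ h = cong (h +_) (+-identityʳ h)

odd-minority : ∀ {h} (c : Coloring n) {z b} → n ≡ suc (2 * h) → c z ≡ b → ∣ colorClass c b ∣ ≡ h → ¬ Majority c z
odd-minority c n≡2h+1 cz count =
  ¬Majority-intro c cz (≤-trans (≤-reflexive (cong (2 *_) count)) (≤-trans (n≤1+n _) (≤-reflexive (sym n≡2h+1))))

minority-after-update : ∀ {h x} {c c′ : Coloring n} → n ≡ suc (2 * h) → ∣ colorClass c true ∣ ≡ suc h →
  AgreeOff ⁅ x ⁆ c c′ → c x ≡ true → c′ x ≡ false → ∀ {z} → c′ z ≡ true → ¬ Majority c′ z
minority-after-update {c′ = c′} n≡2h+1 count agree cx c′x c′z =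
  odd-minority c′ n≡2h+1 c′z (suc-injective (trans (sym (∣colorClass∣-update agree cx (B.not-¬ c′x))) count))

swap-minority : ∀ {h i j} (c : Coloring n) → n ≡ suc (2 * h) → ∣ colorClass c true ∣ ≡ suc h →
  i ≢ j → c i ≡ true → c j ≡ false →
  Σ (Coloring n) λ c′ → AgreeOff (⁅ i ⁆ ∪ ⁅ j ⁆) c c′ × c′ i ≢ c′ j × ¬ Majority c′ i
swap-minority {n = n} {h = h} {i} {j} c n≡2h+1 count i≢j ci cj =
  c′ , agree , (λ e → B.not-¬ c′i (trans e c′j)) , odd-minority c′ {i} n≡2h+1 c′i (trans same-falses falses)
  where
  c₁ c′ : Coloring n
  c₁ = paint ⁅ i ⁆ false c
  c′ = paint ⁅ j ⁆ true c₁
  c₁i : c₁ i ≡ false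
  c₁i = paint-∈ false c (x∈⁅x⁆ i)
  c₁j : c₁ j ≡ false
  c₁j = trans (paint-∉ false c (x≢y⇒x∉⁅y⁆ (i≢j ∘ sym))) cj
  c′i : c′ i ≡ false
  c′i = trans (paint-∉ true c₁ (x≢y⇒x∉⁅y⁆ i≢j)) c₁i
  c′j : c′ j ≡ true
  c′j = paint-∈ true c₁ (x∈⁅x⁆ j)
  agree : AgreeOff (⁅ i ⁆ ∪ ⁅ j ⁆) c c′
  agree y∉ = trans (paint-∉ true c₁ (y∉ ∘ q⊆p∪q ⁅ i ⁆ ⁅ j ⁆)) (paint-∉ false c (y∉ ∘ p⊆p∪q ⁅ j ⁆))
  same-falses : ∣ colorClass c′ false ∣ ≡ ∣ colorClass c false ∣
  same-falses = suc-injective (trans (sym (∣colorClass∣-update (paint-∉ true c₁) c₁j (B.not-¬ c′j)))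
                                     (∣colorClass∣-update (λ y∉ → sym (paint-∉ false c y∉)) c₁i (B.not-¬ ci)))
  falses : ∣ colorClass c false ∣ ≡ h
  falses = ∣colorClass∣-false c (trans n≡2h+1 (cong suc (2*-as-+ h))) count

-- Pairs of differently colored balls

hasDiffPair? : (c : Coloring n) (P : Subset n) → Dec (HasDiffPair c P)
hasDiffPair? c P = FP.any? λ u → FP.any? λ w → u ∈? P ×-dec w ∈? P ×-dec ¬? (c u B.≟ c w)

¬HasDiffPair⇒Mono : ∀ (c : Coloring n) {P} → ¬ HasDiffPair c P → Mono c P
¬HasDiffPair⇒Mono c ¬d u w u∈ w∈ with c u B.≟ c w
... | yes cu≡cw = cu≡cw
... | no  cu≢cw = contradiction (u , w , u∈ , w∈ , cu≢cw) ¬d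

¬Mono⇒HasDiffPair : ∀ (c : Coloring n) {P} → ¬ Mono c P → HasDiffPair c P
¬Mono⇒HasDiffPair c {P} ¬mono = decidable-stable (hasDiffPair? c P) (¬mono ∘ ¬HasDiffPair⇒Mono c)

¬Mono-xnor : ∀ {col : Coloring n} b {e} → ¬ Mono col e → ¬ Mono (λ y → not (col y xor b)) e
¬Mono-xnor b ¬mono mono = ¬mono λ u w u∈ w∈ → xnor-injective b (mono u w u∈ w∈)

diffPair-⊆ : ∀ {c : Coloring n} {p r} → p ⊆ r → HasDiffPair c p → HasDiffPair c r
diffPair-⊆ p⊆r (u , w , u∈ , w∈ , cu≢cw) = u , w , p⊆r u∈ , p⊆r w∈ , cu≢cw

diffPair-transfer : ∀ {R P : Subset n} {c c′} → AgreeOff R c c′ → HasDiffPair c (P ─ R) → HasDiffPair c′ P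
diffPair-transfer {R = R} {P} agree (u , w , u∈ , w∈ , cu≢cw) =
  u , w , p─q⊆p P R u∈ , p─q⊆p P R w∈ ,
  λ c′u≡c′w → cu≢cw (trans (sym (agree (x∈p─q⇒x∉q P R u∈))) (trans c′u≡c′w (agree (x∈p─q⇒x∉q P R w∈))))

Consistent : {A : Set} → (Coloring n → Subset n → A → Set) → (Fin q → Subset n) → (Fin q → A) →
  Coloring n → Set
Consistent V Q r c = ∀ t → V c (Q t) (r t)

Fooled : {A : Set} → (Coloring n → Subset n → A → Set) → (Fin q → Subset n) → (Fin q → A) → Set
Fooled {n} V Q r =
  (Σ (Coloring n) λ c → Consistent V Q r c × Σ (Fin n) (Majority c))
  × ((i : Fin n) → Σ (Coloring n) λ c → Consistent V Q r c × ¬ Majority c i)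

successful⇒¬fooled : ∀ {A : Set} {V : Coloring n → Subset n → A → Set} {Q : Fin q → Subset n} {r} →
  Successful V Q → ¬ Fooled V Q r
successful⇒¬fooled {r = r} success ((c , c-ok , i , maj) , refute) with success c r c-ok
... | inj₁ (z , always) = let (c′ , c′-ok , ¬maj) = refute z in ¬maj (always c′ c′-ok)
... | inj₂ never        = never c c-ok i maj

SplitOff : (Fin q → Subset n) → Coloring n → Subset n → Set
SplitOff Q c R = ∀ t → Nonempty (Q t ∩ R) → HasDiffPair c (Q t ─ R)

-- the answer names a pair outside R whenever there is one, so recoloring R cannot invalidate it
robustBMAnswer : (c : Coloring n) (R P : Subset n) → (Nonempty (P ∩ R) → HasDiffPair c (P ─ R)) →
  Σ (Maybe (Fin n × Fin n)) λ a → ∀ {c′} → AgreeOff R c c′ → BMValid c′ P a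
robustBMAnswer c R P split with hasDiffPair? c (P ─ R)
... | yes (u , w , u∈ , w∈ , cu≢cw) = just (u , w) , λ agree →
  let (_ , _ , u∈P , w∈P , c′u≢c′w) = diffPair-transfer agree (u , w , u∈ , w∈ , cu≢cw) in u∈P , w∈P , c′u≢c′w
... | no ¬d = nothing , mono
  where
  avoids : ∀ {x} → x ∈ P → x ∉ R
  avoids x∈P x∈R = ¬d (split (_ , x∈p∩q⁺ (x∈P , x∈R)))
  mono : ∀ {c′} → AgreeOff R c c′ → Mono c′ P
  mono agree u w u∈ w∈ = trans (agree (avoids u∈))
    (trans (¬HasDiffPair⇒Mono c ¬d u w (x∈p∧x∉q⇒x∈p─q u∈ (avoids u∈)) (x∈p∧x∉q⇒x∈p─q w∈ (avoids w∈)))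
           (sym (agree (avoids w∈))))

robustBMAnswers : (c : Coloring n) (R : Subset n) (Q : Fin q → Subset n) → SplitOff Q c R →
  Σ (Fin q → Maybe (Fin n × Fin n)) λ r → ∀ {c′} → AgreeOff R c c′ → Consistent BMValid Q r c′
robustBMAnswers c R Q split =
  (λ t → proj₁ (robustBMAnswer c R (Q t) (split t))) , λ agree t → proj₂ (robustBMAnswer c R (Q t) (split t)) agree

gmAnswer : (c : Coloring n) (P : Subset n) → Σ Bool (GMValid c P)
gmAnswer c P with hasDiffPair? c P
... | yes d  = true , d
... | no  ¬d = false , ¬HasDiffPair⇒Mono c ¬d

GMValid-robust : ∀ {R P : Subset n} {c c′} a → AgreeOff R c c′ →
  (Nonempty (P ∩ R) → HasDiffPair c P × HasDiffPair c′ P) → GMValid c P a → GMValid c′ P a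
GMValid-robust {R = R} {P} a agree split valid with nonempty? (P ∩ R)
GMValid-robust true  agree split valid | yes meet = proj₂ (split meet)
GMValid-robust false agree split mono  | yes meet =
  let (u , w , u∈ , w∈ , cu≢cw) = proj₁ (split meet) in contradiction (mono u w u∈ w∈) cu≢cw
GMValid-robust {R = R} {P} {c} {c′} a agree split valid | no ¬meet = valid′ a valid
  where
  avoids : ∀ {x} → x ∈ P → x ∉ R
  avoids x∈P x∈R = ¬meet (_ , x∈p∩q⁺ (x∈P , x∈R))
  valid′ : ∀ a → GMValid c P a → GMValid c′ P a
  valid′ true (u , w , u∈ , w∈ , cu≢cw) =
    u , w , u∈ , w∈ , λ e → cu≢cw (trans (sym (agree (avoids u∈))) (trans e (agree (avoids w∈))))
  valid′ false mono u w u∈ w∈ = trans (agree (avoids u∈)) (trans (mono u w u∈ w∈) (sym (agree (avoids w∈))))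

GMConsistent-robust : ∀ {R : Subset n} {Q : Fin q → Subset n} {c c′ r} → SplitOff Q c R →
  AgreeOff R c c′ → Consistent GMValid Q r c → Consistent GMValid Q r c′
GMConsistent-robust {R = R} {Q} {r = r} split agree c-ok t = GMValid-robust (r t) agree
  (λ meet → diffPair-⊆ (p─q⊆p (Q t) R) (split t meet) , diffPair-transfer agree (split t meet)) (c-ok t)

GMConsistent-pairRecoloring : ∀ {Q : Fin q → Subset n} {c c′ r} {i j} →
  SplitOff Q c ⁅ i ⁆ → SplitOff Q c ⁅ j ⁆ →
  AgreeOff (⁅ i ⁆ ∪ ⁅ j ⁆) c c′ → c′ i ≢ c′ j → Consistent GMValid Q r c → Consistent GMValid Q r c′
GMConsistent-pairRecoloring {Q = Q} {c} {c′} {r} {i} {j} splitsᵢ splitsⱼ agree c′i≢c′j c-ok t =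
  GMValid-robust (r t) agree both (c-ok t)
  where
  P = Q t
  meets : ∀ {x} → x ∈ P → Nonempty (P ∩ ⁅ x ⁆)
  meets {x} x∈ = x , x∈p∩q⁺ (x∈ , x∈⁅x⁆ x)
  via : ∀ x → (∀ {y} → y ∈ ⁅ i ⁆ ∪ ⁅ j ⁆ → y ≢ x → y ∉ P) → HasDiffPair c (P - x) →
    HasDiffPair c P × HasDiffPair c′ P
  via x only-x d = diffPair-⊆ (p─q⊆p P ⁅ x ⁆) d , diffPair-transfer agree (diffPair-⊆ (p-x⊆p─r x only-x) d)
  both : Nonempty (P ∩ (⁅ i ⁆ ∪ ⁅ j ⁆)) → HasDiffPair c P × HasDiffPair c′ P
  both meet with i ∈? P | j ∈? P
  ... | yes i∈ | yes j∈ = diffPair-⊆ (p─q⊆p P ⁅ i ⁆) (splitsᵢ t (meets i∈)) , (i , j , i∈ , j∈ , c′i≢c′j)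
  ... | yes i∈ | no  j∉ = via i (λ y∈ y≢i → [ (λ y≡i → contradiction y≡i y≢i) , (λ { refl → j∉ }) ]′ (∈⁅i⁆∪⁅j⁆ y∈))
                                (splitsᵢ t (meets i∈))
  ... | no  i∉ | yes j∈ = via j (λ y∈ y≢j → [ (λ { refl → i∉ }) , (λ y≡j → contradiction y≡j y≢j) ]′ (∈⁅i⁆∪⁅j⁆ y∈))
                                (splitsⱼ t (meets j∈))
  ... | no  i∉ | no  j∉ =
    let y , y∈ = meet ; y∈P , y∈R = x∈p∩q⁻ P _ y∈
    in contradiction y∈P ([ (λ { refl → i∉ }) , (λ { refl → j∉ }) ]′ (∈⁅i⁆∪⁅j⁆ y∈R))

-- c is a tie, while x is a majority ball of c′
evenFooled : ∀ {A : Set} {V : Coloring n → Subset n → A → Set} {Q : Fin q → Subset n} {r} {h x} {c c′} →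
  n ≡ 2 * h → Consistent V Q r c → ∣ colorClass c true ∣ ≡ h →
  Consistent V Q r c′ → AgreeOff ⁅ x ⁆ c c′ → c x ≡ true → c′ x ≡ false → Fooled V Q r
evenFooled {n = n} {h = h} {x} {c} {c′} n≡2h c-ok count c′-ok agree cx c′x =
  (c′ , c′-ok , x , Majority-intro c′ c′x majority) ,
  λ i → c , c-ok , ¬Majority-intro c refl (≤-reflexive (tie (c i)))
  where
  falses : ∣ colorClass c false ∣ ≡ h
  falses = ∣colorClass∣-false c (trans n≡2h (2*-as-+ h)) count
  tie : ∀ b → 2 * ∣ colorClass c b ∣ ≡ n
  tie true  = trans (cong (2 *_) count) (sym n≡2h)
  tie false = trans (cong (2 *_) falses) (sym n≡2h)
  c′-falses : ∣ colorClass c′ false ∣ ≡ suc h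
  c′-falses = trans (∣colorClass∣-update (λ y∉ → sym (agree y∉)) c′x (B.not-¬ cx)) (cong suc falses)
  majority : n < 2 * ∣ colorClass c′ false ∣
  majority = subst₂ _<_ (sym n≡2h) (cong (2 *_) (sym c′-falses)) (*-monoʳ-< 2 (n<1+n h))

-- c has the majority ball i; a ball other than i is refuted by c or by recoloring i
oddFooled : ∀ {A : Set} {V : Coloring n → Subset n → A → Set} {Q : Fin q → Subset n} {r} {h i} {c} →
  n ≡ suc (2 * h) → Consistent V Q r c → ∣ colorClass c true ∣ ≡ suc h → c i ≡ true →
  Consistent V Q r (paint ⁅ i ⁆ false c) → (Σ (Coloring n) λ c₂ → Consistent V Q r c₂ × ¬ Majority c₂ i) →
  Fooled V Q r
oddFooled {n = n} {V = V} {Q} {r} {h} {i} {c} n≡2h+1 c-ok count ci c₁-ok refute-i =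
  (c , c-ok , i , Majority-intro c ci majority) , refute
  where
  majority : n < 2 * ∣ colorClass c true ∣
  majority = subst₂ _<_ (sym n≡2h+1) (sym (trans (cong (2 *_) count) (*-suc 2 h))) (n<1+n _)
  refute : ∀ z → Σ (Coloring n) λ c′ → Consistent V Q r c′ × ¬ Majority c′ z
  refute z with c z in cz | z F.≟ i
  ... | false | _        = c , c-ok , odd-minority c n≡2h+1 cz
                             (∣colorClass∣-false c (trans n≡2h+1 (cong suc (2*-as-+ h))) count)
  ... | true  | yes refl = refute-i
  ... | true  | no  z≢i  = paint ⁅ i ⁆ false c , c₁-ok ,
                           minority-after-update n≡2h+1 count (paint-∉ false c) ci (paint-∈ false c (x∈⁅x⁆ i))
                             (trans (paint-∉ false c (x≢y⇒x∉⁅y⁆ z≢i)) cz)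

-- Hypergraphs

All-lookup⁺ : ∀ {A : Set} {P : A → Set} {L} → All P L → ∀ i → P (List.lookup L i)
All-lookup⁺ pxs i = All.lookup pxs (∈-lookup i)

All-lookup⁻ : ∀ {A : Set} {P : A → Set} {L} → (∀ i → P (List.lookup L i)) → All P L
All-lookup⁻ {P = P} f = All.tabulate λ e∈ → subst P (sym (lookup-index e∈)) (f (index e∈))

IsMinNonB⇒≤length : ∀ {s m} (L : List (Subset n)) → IsMinNonB s m → All (λ e → ∣ e ∣ ≡ s) L →
  (length L < m → ¬ PropertyB (List.lookup L)) → m ≤ length L
IsMinNonB⇒≤length L (_ , minimal) uniform ¬B =
  ≮⇒≥ λ short → <⇒≱ short (minimal _ _ (List.lookup L) (All-lookup⁺ uniform) (¬B short))

combinations : ℕ → (v : ℕ) → List (Subset v)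
combinations zero    v       = ⊥ List.∷ List.[]
combinations (suc s) zero    = List.[]
combinations (suc s) (suc v) =
  List.map (true ∷_) (combinations s v) List.++ List.map (false ∷_) (combinations (suc s) v)

combinations-uniform : ∀ s v → All (λ e → ∣ e ∣ ≡ s) (combinations s v)
combinations-uniform zero    v       = ∣⊥∣≡0 v All.∷ All.[]
combinations-uniform (suc s) zero    = All.[]
combinations-uniform (suc s) (suc v) =
  All.++⁺ (All.map⁺ (All.map (cong suc) (combinations-uniform s v))) (All.map⁺ (combinations-uniform (suc s) v))

combinations-complete : ∀ s (p : Subset n) → s ≤ ∣ p ∣ → Σ (Subset n) λ e → e ∈ₗ combinations s n × e ⊆ p
combinations-complete zero    p           _         = ⊥ , Any.here refl , ⊥⊆
combinations-complete (suc s) (true ∷ p)  (s≤s s≤p) =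
  let e , e∈ , e⊆p = combinations-complete s p s≤p in true ∷ e , ∈-++⁺ˡ (∈-map⁺ (true ∷_) e∈) , s⊆s e⊆p
combinations-complete (suc s) (false ∷ p) s<p       =
  let e , e∈ , e⊆p = combinations-complete (suc s) p s<p
  in false ∷ e , ∈-++⁺ʳ (List.map (true ∷_) (combinations s _)) (∈-map⁺ (false ∷_) e∈) , s⊆s e⊆p

-- one of the two color classes of s + s balls has at least s members, and so contains an edge
combinations-¬B : ∀ s → ¬ PropertyB (List.lookup (combinations s (s + s)))
combinations-¬B s (col , proper) =
  let b , s≤ = large-class
      e , e∈ , e⊆ = combinations-complete s (colorClass col b) s≤
  in All.lookup (All-lookup⁻ {P = λ e → ¬ Mono col e} proper) e∈ λ u w u∈ w∈ →
       trans (∈-colorClass⁻ col (e⊆ u∈)) (sym (∈-colorClass⁻ col (e⊆ w∈)))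
  where
  large-class : Σ Bool λ b → s ≤ ∣ colorClass col b ∣
  large-class with s ≤? ∣ colorClass col true ∣
  ... | yes s≤ = true , s≤
  ... | no  s≰ = false , ≮⇒≥ λ small → <-irrefl (∣colorClass∣-complement col true) (+-mono-< (≰⇒> s≰) small)

IsMinNonB⇒≤combinations : ∀ {s m} → IsMinNonB s m → m ≤ length (combinations s (s + s))
IsMinNonB⇒≤combinations {s} (_ , minimal) =
  minimal _ _ (List.lookup (combinations s (s + s))) (All-lookup⁺ (combinations-uniform s (s + s)))
              (combinations-¬B s)

-- Degrees and links

incidence : (Fin q → Subset n) → Fin n → Subset q
incidence Q x = tabulate (λ t → lookup (Q t) x)

degree : (Fin q → Subset n) → Fin n → ℕ
degree Q x = ∣ incidence Q x ∣

degree-sum : ∀ {k} (Q : Fin q → Subset n) → KUniform k Q → ∑[ x < n ] degree Q x ≡ q * k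
degree-sum {q} {n} {k} Q Q-unif = begin
  ∑[ x < n ] ∣ incidence Q x ∣
    ≡⟨ sum-cong-≗ (∣p∣≡∑ ∘ incidence Q) ⟩
  ∑[ x < n ] ∑[ t < q ] indicator (lookup (incidence Q x) t)
    ≡⟨ sum-cong-≗ (λ x → sum-cong-≗ λ t → cong indicator (lookup∘tabulate (λ t → lookup (Q t) x) t)) ⟩
  ∑[ x < n ] ∑[ t < q ] indicator (lookup (Q t) x)
    ≡⟨ ∑-comm (λ x t → indicator (lookup (Q t) x)) ⟩
  ∑[ t < q ] ∑[ x < n ] indicator (lookup (Q t) x)
    ≡⟨ sum-cong-≗ (λ t → trans (sym (∣p∣≡∑ (Q t))) (Q-unif t)) ⟩
  ∑[ t < q ] k
    ≡⟨ ∑-const q k ⟩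
  q * k
    ∎
  where open ≡-Reasoning

meeting : Subset n → (Fin q → Subset n) → Subset q
meeting R Q = tabulate (λ t → does (nonempty? (Q t ∩ R)))

∈-meeting⁺ : ∀ {R : Subset n} {Q : Fin q → Subset n} {t} → Nonempty (Q t ∩ R) → t ∈ meeting R Q
∈-meeting⁺ {R = R} {Q} {t} meet = lookup⇒[]= t _ (trans (lookup∘tabulate _ t) (dec-true (nonempty? (Q t ∩ R)) meet))

∈-meeting⁻ : ∀ {R : Subset n} {Q : Fin q → Subset n} {t} → t ∈ meeting R Q → Nonempty (Q t ∩ R)
∈-meeting⁻ {R = R} {Q} {t} t∈ = witness (nonempty? (Q t ∩ R)) (trans (sym (lookup∘tabulate _ t)) ([]=⇒lookup t∈))
  where
  witness : ∀ {A : Set} (a? : Dec A) → does a? ≡ true → A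
  witness (yes a) _ = a

meeting⁅x⁆⊆incidence : ∀ (Q : Fin q → Subset n) x → meeting ⁅ x ⁆ Q ⊆ incidence Q x
meeting⁅x⁆⊆incidence Q x {t} t∈ with y , y∈ ← ∈-meeting⁻ t∈ with y∈Qt , y∈⁅x⁆ ← x∈p∩q⁻ (Q t) ⁅ x ⁆ y∈
  rewrite x∈⁅y⁆⇒x≡y x y∈⁅x⁆ = lookup⇒[]= t _ (trans (lookup∘tabulate _ t) ([]=⇒lookup y∈Qt))

meeting-∪ : ∀ (Q : Fin q → Subset n) p r → meeting (p ∪ r) Q ⊆ meeting p Q ∪ meeting r Q
meeting-∪ Q p r {t} t∈ =
  let y , y∈ = ∈-meeting⁻ t∈
      y∈Qt , y∈p∪r = x∈p∩q⁻ (Q t) (p ∪ r) y∈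
      meets : ∀ {s} → y ∈ s → t ∈ meeting s Q
      meets y∈s = ∈-meeting⁺ (y , x∈p∩q⁺ (y∈Qt , y∈s))
  in x∈p∪q⁺ (Sum.map meets meets (x∈p∪q⁻ p r y∈p∪r))

∣meeting⁅i⁆∪⁅j⁆∣≤ : ∀ (Q : Fin q → Subset n) i j → ∣ meeting (⁅ i ⁆ ∪ ⁅ j ⁆) Q ∣ ≤ degree Q i + degree Q j
∣meeting⁅i⁆∪⁅j⁆∣≤ Q i j = begin
  ∣ meeting (⁅ i ⁆ ∪ ⁅ j ⁆) Q ∣             ≤⟨ p⊆q⇒∣p∣≤∣q∣ (meeting-∪ Q ⁅ i ⁆ ⁅ j ⁆) ⟩
  ∣ meeting ⁅ i ⁆ Q ∪ meeting ⁅ j ⁆ Q ∣     ≤⟨ ∣p∪q∣≤∣p∣+∣q∣ (meeting ⁅ i ⁆ Q) (meeting ⁅ j ⁆ Q) ⟩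
  ∣ meeting ⁅ i ⁆ Q ∣ + ∣ meeting ⁅ j ⁆ Q ∣ ≤⟨ +-mono-≤ (p⊆q⇒∣p∣≤∣q∣ (meeting⁅x⁆⊆incidence Q i))
                                                       (p⊆q⇒∣p∣≤∣q∣ (meeting⁅x⁆⊆incidence Q j)) ⟩
  degree Q i + degree Q j                    ∎
  where open ≤-Reasoning

link : ℕ → Subset n → (Fin q → Subset n) → List (Subset n)
link s R Q = select (meeting R Q) (λ t → firsts s (Q t ─ R))

length-link : ∀ s (R : Subset n) (Q : Fin q → Subset n) → length (link s R Q) ≡ ∣ meeting R Q ∣
length-link s R Q = length-select (meeting R Q) (λ t → firsts s (Q t ─ R))

length-link⁅x⁆≤degree : ∀ s (Q : Fin q → Subset n) x → length (link s ⁅ x ⁆ Q) ≤ degree Q x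
length-link⁅x⁆≤degree s Q x = ≤-trans (≤-reflexive (length-link s ⁅ x ⁆ Q)) (p⊆q⇒∣p∣≤∣q∣ (meeting⁅x⁆⊆incidence Q x))

link-uniform : ∀ {k s} {Q : Fin q → Subset n} (R : Subset n) → KUniform k Q → s + ∣ R ∣ ≤ k →
  All (λ e → ∣ e ∣ ≡ s) (link s R Q)
link-uniform {k = k} {s} {Q} R Q-unif s+R≤k =
  select-All (meeting R Q) λ t → trans (∣firsts∣ s (Q t ─ R)) (m≤n⇒m⊓n≡m (fits t))
  where
  fits : ∀ t → s ≤ ∣ Q t ─ R ∣
  fits t = +-cancelʳ-≤ (∣ R ∣) s (∣ Q t ─ R ∣)
    (≤-trans s+R≤k (≤-trans (≤-reflexive (sym (Q-unif t))) (∣p∣≤∣p─q∣+∣q∣ (Q t) R)))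

link⁅x⁆-uniform : ∀ {k} {Q : Fin q → Subset n} x → KUniform k Q → 1 ≤ k →
  All (λ e → ∣ e ∣ ≡ k ∸ 1) (link (k ∸ 1) ⁅ x ⁆ Q)
link⁅x⁆-uniform {k = k} x Q-unif 1≤k =
  link-uniform ⁅ x ⁆ Q-unif (≤-reflexive (trans (cong (k ∸ 1 +_) (∣⁅x⁆∣≡1 x)) (m∸n+n≡m 1≤k)))

link-small : ∀ s (R : Subset n) (Q : Fin q → Subset n) → All (λ e → ∣ e ∣ ≤ s) (link s R Q)
link-small s R Q = select-All (meeting R Q) λ t → ≤-trans (≤-reflexive (∣firsts∣ s (Q t ─ R))) (m⊓n≤m s _)

link⊆∁R : ∀ s (R : Subset n) (Q : Fin q → Subset n) → ⋃ (link s R Q) ⊆ ∁ R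
link⊆∁R s R Q = ⋃⊆ (select-All (meeting R Q) λ t → x∉p⇒x∈∁p ∘ x∈p─q⇒x∉q (Q t) R ∘ firsts-⊆ s (Q t ─ R))

link-splits : ∀ s R (Q : Fin q → Subset n) {c} → All (HasDiffPair c) (link s R Q) → SplitOff Q c R
link-splits s R Q split t meet =
  diffPair-⊆ (firsts-⊆ s (Q t ─ R)) (All.lookup split (∈-select (λ t → firsts s (Q t ─ R)) (∈-meeting⁺ meet)))

∣⋃L∪R∣≤ : ∀ {s} (L : List (Subset n)) (R : Subset n) → All (λ e → ∣ e ∣ ≤ s) L →
  ∣ ⋃ L ∪ R ∣ ≤ length L * s + ∣ R ∣
∣⋃L∪R∣≤ L R small = ≤-trans (∣p∪q∣≤∣p∣+∣q∣ (⋃ L) R) (+-monoˡ-≤ ∣ R ∣ (∣⋃∣≤ L small))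

room-fits : ∀ {ℓ m s k c h} → ℓ < m → s ≤ k → m * k + c ≤ h → ℓ * s + c ≤ h
room-fits {c = c} short s≤k room = ≤-trans (+-monoˡ-≤ c (*-mono-≤ (<⇒≤ short) s≤k)) room

splitColoring : (L : List (Subset n)) (R : Subset n) (col : Coloring n) {a b : ℕ} →
  n ≡ a + b → ∣ ⋃ L ∪ R ∣ ≤ a → ∣ ⋃ L ∪ R ∣ ≤ b →
  All (λ e → ¬ Mono col e) L → (∀ {x} → x ∈ R → x ∈ ⋃ L → col x ≡ true) →
  Σ (Coloring n) λ c → (∀ {x} → x ∈ R → c x ≡ true) × All (HasDiffPair c) L × ∣ colorClass c true ∣ ≡ a
splitColoring L R col n≡a+b F≤a F≤b proper compatible
  with c , agree , count ← balanced (⋃ L ∪ R) (paint R true col) n≡a+b F≤a F≤b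
  = c , onR , All.tabulate split , count
  where
  onR : ∀ {x} → x ∈ R → c x ≡ true
  onR x∈R = trans (agree (x∈p∪q⁺ (inj₂ x∈R))) (paint-∈ true col x∈R)
  onL : ∀ {x} → x ∈ ⋃ L → c x ≡ col x
  onL {x} x∈ with x ∈? R
  ... | yes x∈R = trans (onR x∈R) (sym (compatible x∈R x∈))
  ... | no  x∉R = trans (agree (x∈p∪q⁺ (inj₁ x∈))) (paint-∉ true col x∉R)
  split : ∀ {e} → e ∈ₗ L → HasDiffPair c e
  split e∈ =
    let (u , w , u∈ , w∈ , colu≢colw) = ¬Mono⇒HasDiffPair col (All.lookup proper e∈)
    in u , w , u∈ , w∈ , λ cu≡cw → colu≢colw (trans (sym (onL (⊆⋃ e∈ u∈))) (trans cu≡cw (onL (⊆⋃ e∈ w∈))))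

-- The three lower bounds

module EvenCase {k h} {Q : Fin q → Subset n} (Q-unif : KUniform k Q) (success : Successful BMValid Q)
                (n≡2h : n ≡ 2 * h) (x : Fin n) where

  L : List (Subset n)
  L = link (k ∸ 1) ⁅ x ⁆ Q

  link-¬B : length L * (k ∸ 1) + 1 ≤ h → ¬ PropertyB (List.lookup L)
  link-¬B room (col , proper) =
    let c , c-x , c-splits , count = splitColoring L ⁅ x ⁆ col (trans n≡2h (2*-as-+ h)) F≤h F≤h (All-lookup⁻ proper)
                                       λ y∈R y∈L → contradiction y∈R (x∈∁p⇒x∉p (link⊆∁R (k ∸ 1) ⁅ x ⁆ Q y∈L))
        r , robust = robustBMAnswers c ⁅ x ⁆ Q (link-splits (k ∸ 1) ⁅ x ⁆ Q c-splits)
    in successful⇒¬fooled {V = BMValid} {Q = Q} success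
         (evenFooled {V = BMValid} {Q = Q} n≡2h (robust (λ _ → refl)) count
           (robust (paint-∉ false c)) (paint-∉ false c) (c-x (x∈⁅x⁆ x)) (paint-∈ false c (x∈⁅x⁆ x)))
    where
    F≤h : ∣ ⋃ L ∪ ⁅ x ⁆ ∣ ≤ h
    F≤h = ≤-trans (∣⋃L∪R∣≤ L ⁅ x ⁆ (link-small (k ∸ 1) ⁅ x ⁆ Q))
                  (subst (λ a → length L * (k ∸ 1) + a ≤ h) (sym (∣⁅x⁆∣≡1 x)) room)

  m≤degree : ∀ {m} → 1 ≤ k → IsMinNonB (k ∸ 1) m → m * k + 1 ≤ h → m ≤ degree Q x
  m≤degree 1≤k minimal room = ≤-trans
    (IsMinNonB⇒≤length L minimal (link⁅x⁆-uniform x Q-unif 1≤k) λ short → link-¬B (room-fits short (m∸n≤m k 1) room))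
    (length-link⁅x⁆≤degree (k ∸ 1) Q x)

evenLowerBound : ∀ {n k h m} → 1 ≤ k → n ≡ 2 * h → m * k + 1 ≤ h → IsMinNonB (k ∸ 1) m →
  LowerBound n BMValid k (n * m) k
evenLowerBound {n} {k} {m = m} 1≤k n≡2h room minimal q Q Q-unif success = begin
  n * m                 ≤⟨ ∑-lower (degree Q) (λ x → EvenCase.m≤degree Q-unif success n≡2h x 1≤k minimal room) ⟩
  ∑[ x < n ] degree Q x ≡⟨ degree-sum Q Q-unif ⟩
  q * k                 ≡⟨ *-comm q k ⟩
  k * q                 ∎
  where open ≤-Reasoning

pairedDegrees⇒bound : ∀ {k h m} (Q : Fin q → Subset n) → KUniform k Q → n ≡ suc (2 * h) →
  (∀ i j → i ≢ j → m ≤ degree Q i + degree Q j) → (n ∸ 1) * m ≤ 2 * k * q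
pairedDegrees⇒bound {q} {n} {k} {h} {m} Q Q-unif n≡2h+1 pairs = begin
  (n ∸ 1) * m               ≡⟨ cong (λ n → (n ∸ 1) * m) n≡2h+1 ⟩
  2 * h * m                 ≡⟨ *-assoc 2 h m ⟩
  2 * (h * m)               ≤⟨ *-monoʳ-≤ 2 (∑-pairs h (degree Q) 2h≤n pairs) ⟩
  2 * ∑[ x < n ] degree Q x ≡⟨ cong (2 *_) (trans (degree-sum Q Q-unif) (*-comm q k)) ⟩
  2 * (k * q)               ≡⟨ *-assoc 2 k q ⟨
  2 * k * q                 ∎
  where
  open ≤-Reasoning
  2h≤n : 2 * h ≤ n
  2h≤n = ≤-trans (n≤1+n _) (≤-reflexive (sym n≡2h+1))

module OddBMCase {k h} {Q : Fin q → Subset n} (Q-unif : KUniform k Q) (success : Successful BMValid Q)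
                 (n≡2h+1 : n ≡ suc (2 * h)) {i j : Fin n} (i≢j : i ≢ j) where

  R : Subset n
  R = ⁅ i ⁆ ∪ ⁅ j ⁆

  L : List (Subset n)
  L = link (k ∸ 2) R Q

  link-¬B : length L * (k ∸ 2) + 2 ≤ h → ¬ PropertyB (List.lookup L)
  link-¬B room (col , proper) =
    let c , c-R , c-splits , count = splitColoring L R col (trans n≡2h+1 (cong suc (2*-as-+ h)))
                                       (m≤n⇒m≤1+n F≤h) F≤h (All-lookup⁻ proper)
                                       λ y∈R y∈L → contradiction y∈R (x∈∁p⇒x∉p (link⊆∁R (k ∸ 2) R Q y∈L))
        r , robust = robustBMAnswers c R Q (link-splits (k ∸ 2) R Q c-splits)
        ci = c-R (p⊆p∪q ⁅ j ⁆ (x∈⁅x⁆ i))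
        cj = c-R (q⊆p∪q ⁅ i ⁆ ⁅ j ⁆ (x∈⁅x⁆ j))
    in successful⇒¬fooled {V = BMValid} {Q = Q} success
         (oddFooled {V = BMValid} {Q = Q} n≡2h+1 (robust (λ _ → refl)) count ci
           (robust (AgreeOff-⊆ (p⊆p∪q ⁅ j ⁆) (paint-∉ false c)))
           (paint ⁅ j ⁆ false c , robust (AgreeOff-⊆ (q⊆p∪q ⁅ i ⁆ ⁅ j ⁆) (paint-∉ false c)) ,
            minority-after-update n≡2h+1 count (paint-∉ false c) cj (paint-∈ false c (x∈⁅x⁆ j))
              (trans (paint-∉ false c (x≢y⇒x∉⁅y⁆ i≢j)) ci)))
    where
    F≤h : ∣ ⋃ L ∪ R ∣ ≤ h
    F≤h = ≤-trans (∣⋃L∪R∣≤ L R (link-small (k ∸ 2) R Q)) (≤-trans (+-monoʳ-≤ _ (∣⁅i⁆∪⁅j⁆∣≤2 i j)) room)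

  m≤degree-pair : ∀ {m} → 2 ≤ k → IsMinNonB (k ∸ 2) m → m * k + 2 ≤ h → m ≤ degree Q i + degree Q j
  m≤degree-pair 2≤k minimal room = ≤-trans
    (IsMinNonB⇒≤length L minimal uniform λ short → link-¬B (room-fits short (m∸n≤m k 2) room))
    (≤-trans (≤-reflexive (length-link (k ∸ 2) R Q)) (∣meeting⁅i⁆∪⁅j⁆∣≤ Q i j))
    where
    uniform : All (λ e → ∣ e ∣ ≡ k ∸ 2) L
    uniform = link-uniform R Q-unif (≤-trans (+-monoʳ-≤ (k ∸ 2) (∣⁅i⁆∪⁅j⁆∣≤2 i j)) (≤-reflexive (m∸n+n≡m 2≤k)))

oddBMLowerBound : ∀ {n k h m} → 2 ≤ k → n ≡ suc (2 * h) → m * k + 2 ≤ h → IsMinNonB (k ∸ 2) m →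
  LowerBound n BMValid k ((n ∸ 1) * m) (2 * k)
oddBMLowerBound {h = h} 2≤k n≡2h+1 room minimal q Q Q-unif success =
  pairedDegrees⇒bound {h = h} Q Q-unif n≡2h+1 λ i j i≢j →
    OddBMCase.m≤degree-pair Q-unif success n≡2h+1 i≢j 2≤k minimal room

GMConsistent-minority : ∀ {Q : Fin q → Subset n} {c r} {h i j} → n ≡ suc (2 * h) → ∣ colorClass c true ∣ ≡ suc h →
  i ≢ j → c i ≡ true →
  SplitOff Q c ⁅ i ⁆ → SplitOff Q c ⁅ j ⁆ →
  Consistent GMValid Q r c → Σ (Coloring n) λ c₂ → Consistent GMValid Q r c₂ × ¬ Majority c₂ i
GMConsistent-minority {c = c} {i = i} {j} n≡2h+1 count i≢j ci splitsᵢ splitsⱼ c-ok with c j in cj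
... | true  = paint ⁅ j ⁆ false c , GMConsistent-robust splitsⱼ (paint-∉ false c) c-ok ,
              minority-after-update n≡2h+1 count (paint-∉ false c) cj (paint-∈ false c (x∈⁅x⁆ j))
                (trans (paint-∉ false c (x≢y⇒x∉⁅y⁆ i≢j)) ci)
... | false = let c₂ , agree , differ , ¬maj = swap-minority c n≡2h+1 count i≢j ci cj
              in c₂ , GMConsistent-pairRecoloring splitsᵢ splitsⱼ agree differ c-ok , ¬maj

module OddGMCase {k h} {Q : Fin q → Subset n} (Q-unif : KUniform k Q) (success : Successful GMValid Q)
                 (n≡2h+1 : n ≡ suc (2 * h)) {i j : Fin n} (i≢j : i ≢ j) where

  Lᵢ Lⱼ L : List (Subset n)
  Lᵢ = link (k ∸ 1) ⁅ i ⁆ Q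
  Lⱼ = link (k ∸ 1) ⁅ j ⁆ Q
  L  = Lᵢ List.++ Lⱼ

  -- i and j may lie in edges of L, so instead of painting i the coloring is recolored to make i true
  recentered : Coloring n → Coloring n
  recentered col y = not (col y xor col i)

  link-¬B : length L * (k ∸ 1) + 1 ≤ h → ¬ PropertyB (List.lookup L)
  link-¬B room (col , proper) =
    let c , c-i , c-splits , count = splitColoring L ⁅ i ⁆ (recentered col) (trans n≡2h+1 (cong suc (2*-as-+ h)))
                                       (m≤n⇒m≤1+n F≤h) F≤h (All.map (¬Mono-xnor (col i)) (All-lookup⁻ proper))
                                       (λ y∈⁅i⁆ _ → subst (λ y → recentered col y ≡ true) (sym (x∈⁅y⁆⇒x≡y i y∈⁅i⁆))
                                                      (xnor-refl (col i)))
        ci = c-i (x∈⁅x⁆ i)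
        splitsᵢ = link-splits (k ∸ 1) ⁅ i ⁆ Q (All.++⁻ˡ Lᵢ c-splits)
        splitsⱼ = link-splits (k ∸ 1) ⁅ j ⁆ Q (All.++⁻ʳ Lᵢ c-splits)
        c-ok : Consistent GMValid Q (λ t → proj₁ (gmAnswer c (Q t))) c
        c-ok = λ t → proj₂ (gmAnswer c (Q t))
    in successful⇒¬fooled {V = GMValid} {Q = Q} success
         (oddFooled {V = GMValid} {Q = Q} n≡2h+1 c-ok count ci (GMConsistent-robust splitsᵢ (paint-∉ false c) c-ok)
           (GMConsistent-minority n≡2h+1 count i≢j ci splitsᵢ splitsⱼ c-ok))
    where
    F≤h : ∣ ⋃ L ∪ ⁅ i ⁆ ∣ ≤ h
    F≤h = ≤-trans (∣⋃L∪R∣≤ L ⁅ i ⁆ (All.++⁺ (link-small (k ∸ 1) ⁅ i ⁆ Q) (link-small (k ∸ 1) ⁅ j ⁆ Q)))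
                  (subst (λ a → length L * (k ∸ 1) + a ≤ h) (sym (∣⁅x⁆∣≡1 i)) room)

  m≤degree-pair : ∀ {m} → 1 ≤ k → IsMinNonB (k ∸ 1) m → m * k + 1 ≤ h → m ≤ degree Q i + degree Q j
  m≤degree-pair 1≤k minimal room = ≤-trans
    (IsMinNonB⇒≤length L minimal (All.++⁺ (link⁅x⁆-uniform i Q-unif 1≤k) (link⁅x⁆-uniform j Q-unif 1≤k))
       λ short → link-¬B (room-fits short (m∸n≤m k 1) room))
    (≤-trans (≤-reflexive (length-++ Lᵢ))
             (+-mono-≤ (length-link⁅x⁆≤degree (k ∸ 1) Q i) (length-link⁅x⁆≤degree (k ∸ 1) Q j)))

oddGMLowerBound : ∀ {n k h m} → 1 ≤ k → n ≡ suc (2 * h) → m * k + 1 ≤ h → IsMinNonB (k ∸ 1) m →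
  LowerBound n GMValid k ((n ∸ 1) * m) (2 * k)
oddGMLowerBound {h = h} 1≤k n≡2h+1 room minimal q Q Q-unif success =
  pairedDegrees⇒bound {h = h} Q Q-unif n≡2h+1 λ i j i≢j →
    OddGMCase.m≤degree-pair Q-unif success n≡2h+1 i≢j 1≤k minimal room

BMValid⇒GMValid : ∀ {c : Coloring n} {P} a → BMValid c P a → GMValid c P (is-just a)
BMValid⇒GMValid nothing        mono              = mono
BMValid⇒GMValid (just (u , w)) (u∈ , w∈ , cu≢cw) = u , w , u∈ , w∈ , cu≢cw

GM⇒BM-successful : ∀ {Q : Fin q → Subset n} → Successful GMValid Q → Successful BMValid Q
GM⇒BM-successful success c r c-ok with success c (is-just ∘ r) (λ t → BMValid⇒GMValid (r t) (c-ok t))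
... | inj₁ (z , always) = inj₁ (z , λ c′ c′-ok → always c′ λ t → BMValid⇒GMValid (r t) (c′-ok t))
... | inj₂ never        = inj₂ λ c′ c′-ok → never c′ λ t → BMValid⇒GMValid (r t) (c′-ok t)

BM≤GM : ∀ n k → BMleGM n k
BM≤GM n k q Q Q-unif success = q , Q , Q-unif , GM⇒BM-successful success , ≤-refl

even-half : ∀ n → n % 2 ≡ 0 → n ≡ 2 * (n / 2)
even-half n n%2≡0 = trans (m≡m%n+[m/n]*n n 2) (trans (cong (_+ n / 2 * 2) n%2≡0) (*-comm (n / 2) 2))

odd-half : ∀ n → n % 2 ≡ 1 → n ≡ suc (2 * (n / 2))
odd-half n n%2≡1 = trans (m≡m%n+[m/n]*n n 2) (trans (cong (_+ n / 2 * 2) n%2≡1) (cong suc (*-comm (n / 2) 2)))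

half-≥ : ∀ {X h} → suc (2 * X) ≤ n → n ≤ suc (2 * h) → X ≤ h
half-≥ 1+2X≤n n≤1+2h = *-cancelˡ-≤ 2 (≤-pred (≤-trans 1+2X≤n n≤1+2h))

theorem10 : (k : ℕ) → 3 ≤ k → Σ ℕ λ n₀ → (n : ℕ) → n₀ ≤ n →
    ((n % 2 ≡ 0) →
      ((m : ℕ) → IsMinNonB (k ∸ 1) m → LowerBound n BMValid k (n * m) k)
      × BMleGM n k)
    × ((n % 2 ≡ 1) →
      ((m : ℕ) → IsMinNonB (k ∸ 1) m → LowerBound n GMValid k ((n ∸ 1) * m) (2 * k))
      × ((m : ℕ) → IsMinNonB (k ∸ 2) m → LowerBound n BMValid k ((n ∸ 1) * m) (2 * k)))
theorem10 k 3≤k = suc (2 * X) , λ n n₀≤n →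
  (λ even → let n≡2h = even-half n even ; X≤h = half-≥ {h = n / 2} n₀≤n (≤-trans (≤-reflexive n≡2h) (n≤1+n _)) in
    (λ m minimal → evenLowerBound 1≤k n≡2h (room (n≤1+n 1) (B₁ minimal) X≤h) minimal) , BM≤GM n k) ,
  (λ odd → let n≡2h+1 = odd-half n odd ; X≤h = half-≥ {h = n / 2} n₀≤n (≤-reflexive n≡2h+1) in
    (λ m minimal → oddGMLowerBound 1≤k n≡2h+1 (room (n≤1+n 1) (B₁ minimal) X≤h) minimal) ,
    (λ m minimal → oddBMLowerBound 2≤k n≡2h+1 (room ≤-refl (B₂ minimal) X≤h) minimal))
  where
  1≤k : 1 ≤ k
  1≤k = ≤-trans (s≤s z≤n) 3≤k
  2≤k : 2 ≤ k
  2≤k = ≤-trans (s≤s (s≤s z≤n)) 3≤k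
  -- m(s) is at most the number of s-subsets of a 2s-set
  B X : ℕ
  B = length (combinations (k ∸ 1) _) + length (combinations (k ∸ 2) _)
  X = B * k + 2
  B₁ : ∀ {m} → IsMinNonB (k ∸ 1) m → m ≤ B
  B₁ minimal = ≤-trans (IsMinNonB⇒≤combinations minimal) (m≤m+n _ _)
  B₂ : ∀ {m} → IsMinNonB (k ∸ 2) m → m ≤ B
  B₂ minimal = ≤-trans (IsMinNonB⇒≤combinations minimal) (m≤n+m _ _)
  room : ∀ {m h c} → c ≤ 2 → m ≤ B → X ≤ h → m * k + c ≤ h
  room c≤2 m≤B X≤h = ≤-trans (+-mono-≤ (*-monoˡ-≤ k m≤B) c≤2) X≤h
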